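{- Let $(V,M)$ be an $n$-vertex graph and let $H$ be the graph with vertex set $V(H)=V\cup V_2\cup V_3$, where $V_2,V_3$ are new disjoint vertex sets with $|V_2|=2n$, $|V_3|=n$, and edge set $E(H)=M\cup(V\times V_2)\cup(V_2\times V_3)$. For any good permutation $\pi_H$ of $V(H)$ and any $v\in V$, with $\pi=\pi_H[V]$, we have $T_{\mathcal{O}}(\pi,v)\le O(T_{\mathcal{A}}(\pi_H,v))$, where the constant in the $O(\cdot)$ is absolute.
   Context: A permutation $\pi_H$ of $V(H)$ is good if $\pi_H(1)\in V_3$ and every prefix of $\pi_H$ contains at least as many vertices of $V_2$ as of $V$. $\pi_H[V]$ is the permutation of $V$ listing its elements in the order they appear in $\pi_H$. The oracle $\mathcal{O}(\pi,v)$ on $(V,M)$: let $k=\pi^{ -1}(v)$; for $i=1,\dots,k-1$, query whether $(\pi(i),v)\in M$; if so and $\mathcal{O}(\pi,\pi(i))$ (computed recursively) returns true, return false; after the loop return true. $T_{\mathcal{O}}(\pi,v)$ is its total running time including recursive calls, each adjacency-matrix query costing $O(1)$. The oracle $\mathcal{A}(\pi_H,v)$ on $H$: let $u_1,\dots,u_r$ be the neighbors of $v$ in $H$ sorted in increasing order of rank in $\pi_H$; for $i=1,\dots,r$, if $u_i$ has lower rank than $v$ and $\mathcal{A}(\pi_H,u_i)$ (computed recursively) returns true, return false; after the loop return true. $T_{\mathcal{A}}(\pi_H,v)$ is the total number of recursive calls to $\mathcal{A}$ made for the query $\mathcal{A}(\pi_H,v)$. -}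

module Defs where

open import Data.Nat using (ℕ; zero; suc; _+_; _*_; _≤_)
open import Data.Bool using (Bool; true; false; not)
open import Data.Fin using (Fin)
open import Data.Fin.Properties using () renaming (_≟_ to _≟ᶠ_)
open import Data.Sum using (_⊎_; inj₁; inj₂)
open import Data.Sum.Properties using (≡-dec)
open import Data.Product using (_×_; _,_; proj₁; proj₂)
open import Data.List using (List; []; _∷_; _++_; map; foldl; _∷ʳ_; takeWhile; take; allFin)
open import Data.Unit using (⊤)
open import Data.Empty using (⊥)
open import Relation.Nullary.Decidable using (¬?)
open import Relation.Binary.Definitions using (DecidableEquality)
open import Relation.Binary.PropositionalEquality using (_≡_)

SimpleGraph : {n : ℕ} → (Fin n → Fin n → Bool) → Set
SimpleGraph {n} M = (∀ a b → M a b ≡ M b a) × (∀ a → M a a ≡ false)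

-- The graph H on V(H) = V ∪ V₂ ∪ V₃ with |V₂| = 2n, |V₃| = n

VH : ℕ → Set
VH n = Fin n ⊎ (Fin (2 * n) ⊎ Fin n)

adjH : {n : ℕ} → (Fin n → Fin n → Bool) → VH n → VH n → Bool
adjH M (inj₁ a)        (inj₁ b)        = M a b
adjH M (inj₁ _)        (inj₂ (inj₁ _)) = true
adjH M (inj₂ (inj₁ _)) (inj₁ _)        = true
adjH M (inj₂ (inj₁ _)) (inj₂ (inj₂ _)) = true
adjH M (inj₂ (inj₂ _)) (inj₂ (inj₁ _)) = true
adjH M _               _               = false

-- the list of all vertices of H (a permutation of V(H) is a list ↭ allVH n)
allVH : (n : ℕ) → List (VH n)
allVH n = map inj₁ (allFin n) ++ (map (λ x → inj₂ (inj₁ x)) (allFin (2 * n))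
                                 ++ map (λ x → inj₂ (inj₂ x)) (allFin n))

_≟H_ : {n : ℕ} → DecidableEquality (VH n)
_≟H_ = ≡-dec _≟ᶠ_ (≡-dec _≟ᶠ_ _≟ᶠ_)

numV : {n : ℕ} → List (VH n) → ℕ
numV []             = zero
numV (inj₁ _ ∷ xs)  = suc (numV xs)
numV (inj₂ _ ∷ xs)  = numV xs

numV2 : {n : ℕ} → List (VH n) → ℕ
numV2 []                   = zero
numV2 (inj₂ (inj₁ _) ∷ xs) = suc (numV2 xs)
numV2 (_ ∷ xs)             = numV2 xs

HeadInV3 : {n : ℕ} → List (VH n) → Set
HeadInV3 []                   = ⊥
HeadInV3 (inj₂ (inj₂ _) ∷ _)  = ⊤
HeadInV3 (_ ∷ _)              = ⊥

Good : {n : ℕ} → List (VH n) → Set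
Good πH = HeadInV3 πH × (∀ j → numV (take j πH) ≤ numV2 (take j πH))

restrictV : {n : ℕ} → List (VH n) → List (Fin n)
restrictV []            = []
restrictV (inj₁ a ∷ xs) = a ∷ restrictV xs
restrictV (inj₂ _ ∷ xs) = restrictV xs

-- Generic recursive greedy oracle on an ordering, with cost accounting.
--
-- An entry (a , b , c) describes an earlier element w (in order): a = whether
-- w is adjacent to the queried vertex, b = the oracle's answer on w,
-- c = the total cost of the oracle call on w.
-- 'loop qc' runs the for-loop: each iteration costs qc (the adjacency query);
-- if adjacent, the recursive call is made (cost c) and if it returned true
-- the loop returns false.  Returns (answer , cost of the loop).

loop : ℕ → List (Bool × Bool × ℕ) → Bool × ℕ
loop qc []                        = true , zero
loop qc ((false , _ , _) ∷ rest)  = proj₁ (loop qc rest) , qc + proj₂ (loop qc rest)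
loop qc ((true , true , c) ∷ _)   = false , qc + c
loop qc ((true , false , c) ∷ rest) = proj₁ (loop qc rest) , qc + c + proj₂ (loop qc rest)

module _ {X : Set} (adj : X → X → Bool) (qc : ℕ) where

  -- answer and total cost of the oracle call on x, given the results
  -- (element , answer , cost) for all earlier elements in order.
  -- The call itself contributes 1.
  entry : List (X × Bool × ℕ) → X → Bool × ℕ
  entry acc x = proj₁ r , suc (proj₂ r)
    where r = loop qc (map (λ e → adj (proj₁ e) x , proj₂ e) acc)

  run : List X → List (X × Bool × ℕ)
  run = foldl (λ acc x → acc ∷ʳ (x , entry acc x)) []

  before : DecidableEquality X → List X → X → List X
  before _≟_ π v = takeWhile (λ x → ¬? (x ≟ v)) π

  cost : DecidableEquality X → List X → X → ℕ
  cost _≟_ π v = proj₂ (entry (run (before _≟_ π v)) v)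

-- T_O(π , v): adjacency queries cost 1 each, plus 1 per call
T-O : {n : ℕ} → (Fin n → Fin n → Bool) → List (Fin n) → Fin n → ℕ
T-O M π v = cost M 1 _≟ᶠ_ π v

-- T_A(πH , v): number of calls to 𝒜 (including the top-level call)
T-A : {n : ℕ} → (Fin n → Fin n → Bool) → List (VH n) → VH n → ℕ
T-A M πH v = cost (adjH M) 0 _≟H_ πH v

-- Run 𝒜 on H along πH and 𝒪 along π = πH[V] side by side.  The first vertex of πH lies in V₃ and
-- answers true; it is adjacent to every vertex of V₂, so 𝒜 answers false on all of V₂, and on V
-- both oracles then give the same answers, with 𝒪 never costlier on a recursive call.  The only
-- extra cost of 𝒪 is one adjacency query per earlier vertex of V it scans; 𝒜, which scans the
-- same prefix, makes a recursive call on each of its V₂-vertices (all adjacent to V), and a good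
-- permutation has at least as many of those in every prefix.  Hence T_𝒪 ≤ T_𝒜, with constant 1.
module Submission where

open import Defs
open import Data.Nat using (ℕ; zero; suc; _+_; _*_; _≤_; s≤s; s≤s⁻¹; z≤n)
open import Data.Nat.Properties
  using (≤-trans; ≤-reflexive; m≤n+m; +-mono-≤; +-monoʳ-≤; +-suc; *-identityˡ; +-commutativeSemigroup; module ≤-Reasoning)
open import Algebra.Properties.CommutativeSemigroup +-commutativeSemigroup using (x∙yz≈y∙xz)
open import Data.Bool using (Bool; true; false)
open import Data.Fin using (Fin)
open import Data.Fin.Properties using () renaming (_≟_ to _≟ᶠ_)
open import Data.Sum using (inj₁; inj₂)
open import Data.Product using (∃-syntax; _×_; _,_; proj₁; proj₂; map₂)
open import Data.List using (List; []; _∷_; _++_; [_]; map; foldl; _∷ʳ_; takeWhile; take)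
open import Data.List.Properties using (++-assoc; ++-identityʳ; takeWhile++dropWhile)
open import Data.List.Relation.Binary.Permutation.Propositional using (_↭_)
open import Relation.Nullary using (Dec; yes; no; ¬_)
open import Relation.Nullary.Decidable using (¬?)
open import Relation.Binary.PropositionalEquality using (_≡_; refl; sym; cong; subst; subst₂)

-- A ballot sequence: the index is the surplus of V₂- over V-vertices available before the list.
data Ballot {n : ℕ} : ℕ → List (VH n) → Set where
  []   : ∀ {d} → Ballot d []
  V∷_  : ∀ {d a L} → Ballot d L → Ballot (suc d) (inj₁ a ∷ L)
  V₂∷_ : ∀ {d u L} → Ballot (suc d) L → Ballot d (inj₂ (inj₁ u) ∷ L)
  V₃∷_ : ∀ {d w L} → Ballot d L → Ballot d (inj₂ (inj₂ w) ∷ L)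

prefixBound⇒Ballot : ∀ {n} d (L : List (VH n)) →
                     (∀ j → numV (take j L) ≤ d + numV2 (take j L)) → Ballot d L
prefixBound⇒Ballot d []                    _     = []
prefixBound⇒Ballot zero (inj₁ _ ∷ _)       bound with () ← bound 1
prefixBound⇒Ballot (suc d) (inj₁ _ ∷ L)    bound =
  V∷ prefixBound⇒Ballot d L (λ j → s≤s⁻¹ (bound (suc j)))
prefixBound⇒Ballot d (inj₂ (inj₁ _) ∷ L) bound =
  V₂∷ prefixBound⇒Ballot (suc d) L (λ j → subst (numV (take j L) ≤_) (+-suc d _) (bound (suc j)))
prefixBound⇒Ballot d (inj₂ (inj₂ _) ∷ L) bound =
  V₃∷ prefixBound⇒Ballot d L (λ j → bound (suc j))

Ballot-++⁻ˡ : ∀ {n d} (P : List (VH n)) {L} → Ballot d (P ++ L) → Ballot d P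
Ballot-++⁻ˡ []                    _        = []
Ballot-++⁻ˡ (inj₁ _ ∷ P)          (V∷ b)  = V∷ Ballot-++⁻ˡ P b
Ballot-++⁻ˡ (inj₂ (inj₁ _) ∷ P) (V₂∷ b) = V₂∷ Ballot-++⁻ˡ P b
Ballot-++⁻ˡ (inj₂ (inj₂ _) ∷ P) (V₃∷ b) = V₃∷ Ballot-++⁻ˡ P b

restrictV-takeWhile : ∀ {n} (v : Fin n) L →
  takeWhile (λ x → ¬? (x ≟ᶠ v)) (restrictV L) ≡ restrictV (takeWhile (λ x → ¬? (x ≟H inj₁ v)) L)
restrictV-takeWhile v []           = refl
restrictV-takeWhile v (inj₁ a ∷ L) with a ≟ᶠ v
... | yes refl = refl
... | no _     = cong (a ∷_) (restrictV-takeWhile v L)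
restrictV-takeWhile v (inj₂ _ ∷ L) = restrictV-takeWhile v L

module Simulation {n : ℕ} (M : Fin n → Fin n → Bool) where

  data Simulates : List (VH n) → List (VH n × Bool × ℕ) → List (Fin n × Bool × ℕ) → Set where
    []   : Simulates [] [] []
    onV  : ∀ {P ra ro a bA bO cA cO} → bO ≡ bA → cO ≤ cA → Simulates P ra ro →
           Simulates (inj₁ a ∷ P) ((inj₁ a , bA , cA) ∷ ra) ((a , bO , cO) ∷ ro)
    onV₂ : ∀ {P ra ro u c} → Simulates P ra ro →
           Simulates (inj₂ (inj₁ u) ∷ P) ((inj₂ (inj₁ u) , false , suc c) ∷ ra) ro
    onV₃ : ∀ {P ra ro w b c} → Simulates P ra ro →
           Simulates (inj₂ (inj₂ w) ∷ P) ((inj₂ (inj₂ w) , b , c) ∷ ra) ro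

  _++ˢ_ : ∀ {P₁ ra₁ ro₁ P₂ ra₂ ro₂} → Simulates P₁ ra₁ ro₁ → Simulates P₂ ra₂ ro₂ →
          Simulates (P₁ ++ P₂) (ra₁ ++ ra₂) (ro₁ ++ ro₂)
  []           ++ˢ t = t
  onV eq le s ++ˢ t = onV eq le (s ++ˢ t)
  onV₂ s       ++ˢ t = onV₂ (s ++ˢ t)
  onV₃ s       ++ˢ t = onV₃ (s ++ˢ t)

  loop𝒪 : Fin n → List (Fin n × Bool × ℕ) → Bool × ℕ
  loop𝒪 v ro = loop 1 (map (λ e → M (proj₁ e) v , proj₂ e) ro)

  loop𝒜 : Fin n → List (VH n × Bool × ℕ) → Bool × ℕ
  loop𝒜 v ra = loop 0 (map (λ e → adjH M (proj₁ e) (inj₁ v) , proj₂ e) ra)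

  loop-simulation : ∀ {P ra ro d} (v : Fin n) → Simulates P ra ro → Ballot d P →
    proj₁ (loop𝒪 v ro) ≡ proj₁ (loop𝒜 v ra) × proj₂ (loop𝒪 v ro) ≤ d + proj₂ (loop𝒜 v ra)
  loop-simulation v [] [] = refl , z≤n
  loop-simulation v (onV {a = a} _ _ _) (V∷ _) with M a v
  loop-simulation v (onV refl _ s) (V∷ b) | false = map₂ s≤s (loop-simulation v s b)
  loop-simulation {d = suc d} v (onV {bA = true} {cA = cA} refl le s) (V∷ b) | true =
    refl , s≤s (≤-trans le (m≤n+m cA d))
  loop-simulation {d = suc d} v (onV {bA = false} {cA = cA} refl le s) (V∷ b) | true =
    proj₁ ih , s≤s (≤-trans (+-mono-≤ le (proj₂ ih)) (≤-reflexive (x∙yz≈y∙xz cA d _)))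
    where ih = loop-simulation v s b
  loop-simulation {ro = ro} {d} v (onV₂ {ra = ra} {c = c} s) (V₂∷ b) =
    proj₁ ih , (begin
      proj₂ (loop𝒪 v ro)         ≤⟨ proj₂ ih ⟩
      suc (d + r)                 ≤⟨ s≤s (+-monoʳ-≤ d (m≤n+m r c)) ⟩
      suc (d + (c + r))           ≡⟨ sym (+-suc d (c + r)) ⟩
      d + suc (c + r)             ∎)
    where
    open ≤-Reasoning
    ih = loop-simulation v s b
    r = proj₂ (loop𝒜 v ra)
  loop-simulation v (onV₃ s) (V₃∷ b) = loop-simulation v s b

  entry-simulation : ∀ {P ra ro} (v : Fin n) → Simulates P ra ro → Ballot 0 P →
    proj₁ (entry M 1 ro v) ≡ proj₁ (entry (adjH M) 0 ra (inj₁ v)) ×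
    proj₂ (entry M 1 ro v) ≤ proj₂ (entry (adjH M) 0 ra (inj₁ v))
  entry-simulation v s b = map₂ s≤s (loop-simulation v s b)

  step𝒜 : List (VH n × Bool × ℕ) → VH n → List (VH n × Bool × ℕ)
  step𝒜 acc x = acc ∷ʳ (x , entry (adjH M) 0 acc x)

  step𝒪 : List (Fin n × Bool × ℕ) → Fin n → List (Fin n × Bool × ℕ)
  step𝒪 acc x = acc ∷ʳ (x , entry M 1 acc x)

  -- The V₃-head answering true is what makes 𝒜 answer false on V₂.
  step-simulation : ∀ {P w c ra ro} x →
    Simulates P ((inj₂ (inj₂ w) , true , c) ∷ ra) ro → Ballot 0 P →
    Simulates (P ∷ʳ x) (step𝒜 ((inj₂ (inj₂ w) , true , c) ∷ ra) x) (foldl step𝒪 ro (restrictV [ x ]))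
  step-simulation (inj₁ a) s b = s ++ˢ onV (proj₁ r) (proj₂ r) []
    where r = entry-simulation a s b
  step-simulation (inj₂ (inj₁ u)) s _ = subst (Simulates _ _) (++-identityʳ _) (s ++ˢ onV₂ [])
  step-simulation (inj₂ (inj₂ w)) s _ = subst (Simulates _ _) (++-identityʳ _) (s ++ˢ onV₃ [])

  foldl-restrictV-∷ : ∀ {B : Set} (f : B → Fin n → B) acc x L →
    foldl f (foldl f acc (restrictV [ x ])) (restrictV L) ≡ foldl f acc (restrictV (x ∷ L))
  foldl-restrictV-∷ f acc (inj₁ _) L = refl
  foldl-restrictV-∷ f acc (inj₂ _) L = refl

  run-simulation-from : ∀ {P w c ra ro} L →
    Simulates P ((inj₂ (inj₂ w) , true , c) ∷ ra) ro → Ballot 0 (P ++ L) →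
    Simulates (P ++ L) (foldl step𝒜 ((inj₂ (inj₂ w) , true , c) ∷ ra) L) (foldl step𝒪 ro (restrictV L))
  run-simulation-from {P} [] s _ = subst (λ Q → Simulates Q _ _) (sym (++-identityʳ P)) s
  run-simulation-from {P} {ro = ro} (x ∷ L) s b =
    subst₂ (λ Q ro′ → Simulates Q _ ro′) (++-assoc P [ x ] L) (foldl-restrictV-∷ step𝒪 ro x L)
      (run-simulation-from L (step-simulation x s (Ballot-++⁻ˡ P b)) b′)
    where
    b′ : Ballot 0 ((P ∷ʳ x) ++ L)
    b′ = subst (Ballot 0) (sym (++-assoc P [ x ] L)) b

  run-simulation : (P : List (VH n)) → HeadInV3 P → Ballot 0 P →
                   Simulates P (run (adjH M) 0 P) (run M 1 (restrictV P))
  run-simulation (inj₂ (inj₂ w) ∷ L) _ b = run-simulation-from L (onV₃ []) b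

T-O≤T-A : ∀ {n} (M : Fin n → Fin n → Bool) (πH : List (VH n)) → Good πH → (v : Fin n) →
          T-O M (restrictV πH) v ≤ T-A M πH (inj₁ v)
T-O≤T-A M []                     (() , _) v
T-O≤T-A M (inj₁ _ ∷ _)           (() , _) v
T-O≤T-A M (inj₂ (inj₁ _) ∷ _)  (() , _) v
T-O≤T-A {n} M πH@(inj₂ (inj₂ _) ∷ _) (_ , bound) v = begin
  T-O M (restrictV πH) v                       ≡⟨ cong (λ L → proj₂ (entry M 1 (run M 1 L) v))
                                                       (restrictV-takeWhile v πH) ⟩
  proj₂ (entry M 1 (run M 1 (restrictV P)) v) ≤⟨ proj₂ (entry-simulation v (run-simulation P _ ballotP) ballotP) ⟩
  T-A M πH (inj₁ v)                            ∎
  where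
  open ≤-Reasoning
  open Simulation M
  notV : (x : VH n) → Dec (¬ x ≡ inj₁ v)
  notV x = ¬? (x ≟H inj₁ v)
  P : List (VH n)
  P = takeWhile notV πH
  ballotP : Ballot 0 P
  ballotP = Ballot-++⁻ˡ P (subst (Ballot 0) (sym (takeWhile++dropWhile notV πH))
                                  (prefixBound⇒Ballot 0 πH bound))

lemma3p12 : ∃[ C ] (∀ (n : ℕ) (M : Fin n → Fin n → Bool) → SimpleGraph M →
    (πH : List (VH n)) → πH ↭ allVH n → Good πH → (v : Fin n) →
    T-O M (restrictV πH) v ≤ C * T-A M πH (inj₁ v))
lemma3p12 = 1 , λ n M _ πH _ good v →
  ≤-trans (T-O≤T-A M πH good v) (≤-reflexive (sym (*-identityˡ _)))
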